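{- Fix $\sigma\in\mathcal{S}_n$ and $p\in[0,1]$, and let $M$ be the $p$-mix on $M^*$ and the blind choice $\tilde M$. Then the sequence $q_{k,n}=\Pr[CM(\sigma,\tau)=\sigma_k]$, $k\in\{1,\dots,n\}$, is non-increasing in $k$.
   Context: Candidates $\mathcal{C}=\{C_1,\dots,C_n\}$; a qualification ordering $\sigma=(\sigma_1,\dots,\sigma_n)\in\mathcal{S}_n$ is a permutation of $\mathcal{C}$ meaning $\sigma_1>\dots>\sigma_n$; a time ordering $\tau=(\tau_1,\dots,\tau_n)$ is a permutation giving the arrival order, chosen uniformly at random among all $n!$. For a stopping algorithm $M$, $CM(\sigma,\tau):=\tau_{M(\sigma,\tau)}$ is the selected candidate. The threshold $t_n$ is the smallest integer $t$ with $\frac1t+\dots+\frac1{n-1}\le 1$. The secretary algorithm $M^*$ stops at the first $k\ge t_n$ such that $\tau_k$ is the best (under $\sigma$) among $\tau_1,\dots,\tau_k$, and at $n$ if no such $k$ exists. The blind choice $\tilde M$ always stops at time $1$. The $p$-mix on $M^*$ and $\tilde M$ tosses an independent coin with heads probability $p$ and plays $M^*$ on heads, $\tilde M$ on tails.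
   Formalization: The mixing probability p ranges over the rationals in [0,1]. -}

module Defs where

open import Data.Nat as ℕ using (ℕ; zero; suc; _!)
open import Data.Nat.Properties using (_!≢0)
open import Data.Bool using (Bool; true; false; if_then_else_; _∧_; not)
open import Data.Fin as Fin using (Fin; toℕ)
open import Data.Fin.Permutation using (Permutation′; _⟨$⟩ʳ_; _⟨$⟩ˡ_)
open import Data.List as List using (List; []; _∷_; _++_; [_]; length; filter; concatMap; map)
open import Data.Bool.ListAction using (all; any)
open import Data.Maybe using (Maybe; just; nothing)
import Data.Maybe.Properties as MaybeP
open import Data.Integer using (+_)
open import Data.Rational as ℚ using (ℚ; _/_; 0ℚ; 1ℚ; _≤ᵇ_)
open import Relation.Nullary.Decidable using (⌊_⌋)
open import Relation.Binary.PropositionalEquality using (_≡_)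

-- A qualification ordering σ ∈ S_n is a
-- permutation σ : Permutation′ n, where  σ ⟨$⟩ʳ k  is σ_{k+1}, the
-- candidate of (0-indexed) rank k (rank 0 = best).

rank : ∀ {n} → Permutation′ n → Fin n → ℕ
rank σ c = toℕ (σ ⟨$⟩ˡ c)

better : ∀ {n} → Permutation′ n → Fin n → Fin n → Bool
better σ c d = ⌊ rank σ c ℕ.<? rank σ d ⌋

-- Time orderings: lists (τ_1, …, τ_n) of candidates in arrival order
-- that are permutations of C.  We enumerate all lists of length n over
-- Fin n and keep those without repetition: exactly the n! permutations.

allLists : (m : ℕ) (n : ℕ) → List (List (Fin n))
allLists zero    n = [] ∷ []
allLists (suc m) n = concatMap (λ c → map (c ∷_) (allLists m n)) (List.allFin n)

distinct : ∀ {n} → List (Fin n) → Bool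
distinct []       = true
distinct (x ∷ xs) = not (any (λ y → ⌊ x Fin.≟ y ⌋) xs) ∧ distinct xs

timeOrderings : (n : ℕ) → List (List (Fin n))
timeOrderings n = filter (λ τ → Data.Bool._≟_ (distinct τ) true) (allLists n n)
  where import Data.Bool

-- Threshold t_n : the smallest integer t ≥ 1 with 1/t + … + 1/(n-1) ≤ 1.

harmFrom : (s : ℕ) (count : ℕ) → ℚ
harmFrom s zero        = 0ℚ
harmFrom s (suc count) = ((+ 1) / suc s) ℚ.+ harmFrom (suc s) count

harm : (t n : ℕ) → ℚ                 -- Σ_{i=t}^{n-1} 1/i, for t ≥ 1
harm zero    n = 0ℚ                   -- unused (t ≥ 1)
harm (suc s) n = harmFrom s (n ℕ.∸ suc s)

-- search t = s+1, s+2, …, with fuel; t = n always satisfies the condition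
thresholdSearch : (s fuel n : ℕ) → ℕ
thresholdSearch s zero       n = suc s
thresholdSearch s (suc fuel) n =
  if harm (suc s) n ≤ᵇ 1ℚ then suc s else thresholdSearch (suc s) fuel n

threshold : ℕ → ℕ
threshold n = thresholdSearch 0 n n

-- Secretary algorithm M*: stop at the first time k ≥ t_n (1-indexed)
-- such that τ_k is the best among τ_1,…,τ_k; at time n if none exists.
-- secGo t σ k prefix rest : current time k (1-indexed) of head of rest,
-- prefix = candidates seen before time k.

secGo : ∀ {n} → ℕ → Permutation′ n → ℕ → List (Fin n) → List (Fin n) → Maybe (Fin n)
secGo t σ k pre []           = nothing
secGo t σ k pre (x ∷ [])     = just x
secGo t σ k pre (x ∷ y ∷ ys) =
  if ⌊ t ℕ.≤? k ⌋ ∧ all (λ z → better σ x z) pre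
  then just x
  else secGo t σ (suc k) (pre ++ [ x ]) (y ∷ ys)

secretary : ∀ {n} → Permutation′ n → List (Fin n) → Maybe (Fin n)
secretary {n} σ τ = secGo (threshold n) σ 1 [] τ

blind : ∀ {n} → Permutation′ n → List (Fin n) → Maybe (Fin n)
blind σ []      = nothing
blind σ (x ∷ _) = just x

-- Probabilities over uniformly random τ (n! equally likely orderings).

countSel : ∀ {n} → (Permutation′ n → List (Fin n) → Maybe (Fin n)) →
           Permutation′ n → Fin n → ℕ
countSel {n} alg σ c =
  length (filter (λ τ → MaybeP.≡-dec Fin._≟_ (alg σ τ) (just c)) (timeOrderings n))

probSel : ∀ {n} → (Permutation′ n → List (Fin n) → Maybe (Fin n)) →
          Permutation′ n → Fin n → ℚ
probSel {n} alg σ c = ((+ countSel alg σ c) / (n !)) {{n !≢0}}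

-- p-mix on M* and M̃ (independent coin, heads prob. p plays M*):
-- q_{k,n} = Pr[CM(σ,τ) = σ_k] = p·Pr[CM*(σ,τ)=σ_k] + (1-p)·Pr[CM̃(σ,τ)=σ_k].
-- k is 0-indexed here: k : Fin n stands for σ_{k+1}.
qMix : ∀ {n} → ℚ → Permutation′ n → Fin n → ℚ
qMix p σ k =
  p ℚ.* probSel secretary σ (σ ⟨$⟩ʳ k)
  ℚ.+ (1ℚ ℚ.- p) ℚ.* probSel blind σ (σ ⟨$⟩ʳ k)

-- Swapping the candidates x, y of adjacent ranks k and k+1 in every arrival
-- order permutes the arrival orders.  Since x and y are adjacent in rank, the
-- swap preserves every comparison except the one between x and y.  So if the
-- secretary algorithm selects y from τ, its run on the swapped order makes the
-- same decisions until the arrival time of y, where it meets x and accepts it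
-- because it would have accepted y.  Blind choice obviously behaves the same
-- way.  Hence for both algorithms at least as many arrival orders select the
-- rank-k candidate as the rank-(k+1) one, and the p-mix inherits this.
module Submission where

open import Defs
open import Data.Nat using (ℕ)
open import Data.Fin using (Fin)
open import Data.Fin.Permutation using (Permutation′)
open import Data.Rational using (ℚ; 0ℚ; 1ℚ; _≤_)

open import Data.Bool using (Bool; true; false; if_then_else_; not; _∧_; _∨_)
open import Data.Bool.ListAction using (and; or; all; any)
open import Data.Bool.Properties using (∨-zeroʳ)
open import Data.Fin as Fin using (toℕ)
import Data.Fin.Properties as Fin
open import Data.Fin.Induction using (<-weakInduction-startingFrom)
open import Data.Fin.Permutation using (_⟨$⟩ʳ_; _⟨$⟩ˡ_; inverseˡ; inverseʳ)
import Data.Fin.Permutation as Perm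
import Data.Fin.Permutation.Components as PC
open import Data.Integer using (+_; +≤+)
import Data.Integer.Properties as ℤ
open import Data.List as List using (List; []; _∷_; _++_; map; concatMap; filter; length; allFin; tabulate)
open import Data.List.Membership.Propositional using (_∈_; _∉_)
open import Data.List.Properties using (map-++; map-∘; map-cong)
open import Data.List.Relation.Unary.Any using (here; there)
open import Data.Maybe using (Maybe; just)
open import Data.Maybe.Properties as Maybe using (just-injective)
open import Data.Nat as ℕ using (zero; suc; z≤n)
import Data.Nat.Properties as ℕ
open import Data.Nat.ListAction using (sum)
open import Data.Nat.ListAction.Properties using (sum-++)
open import Data.Product using (_,_)
import Data.Rational as ℚ
import Data.Rational.Properties as ℚ
import Data.Rational.Unnormalised as ℚᵘ
import Data.Rational.Unnormalised.Properties as ℚᵘ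
open import Function using (_∘_; id)
open import Function.Bundles using (mk⇔)
open import Function.Definitions using (Injective)
open import Level using (Level)
open import Relation.Binary.PropositionalEquality
open import Relation.Nullary using (does; yes; no; contradiction)
open import Relation.Nullary.Decidable using (⌊_⌋; dec-true; dec-false; does-⇔; isYes≗does)
open import Relation.Unary using (Pred; Decidable)
open import Relation.Unary.Properties using (_∩?_)
import Algebra.Properties.CommutativeMonoid.Sum as CommutativeMonoidSum

private
  variable
    A B : Set
    ℓ : Level

sumBy : (A → ℕ) → List A → ℕ
sumBy g xs = sum (map g xs)

sumBy-++ : ∀ (g : A → ℕ) xs ys → sumBy g (xs ++ ys) ≡ sumBy g xs ℕ.+ sumBy g ys
sumBy-++ g xs ys = trans (cong sum (map-++ g xs ys)) (sum-++ (map g xs) (map g ys))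

sumBy-map : ∀ (g : B → ℕ) (h : A → B) xs → sumBy g (map h xs) ≡ sumBy (g ∘ h) xs
sumBy-map g h xs = cong sum (sym (map-∘ xs))

sumBy-cong : ∀ {g h : A → ℕ} → (∀ x → g x ≡ h x) → ∀ xs → sumBy g xs ≡ sumBy h xs
sumBy-cong g≗h xs = cong sum (map-cong g≗h xs)

sumBy-mono : ∀ {g h : A → ℕ} → (∀ x → g x ℕ.≤ h x) → ∀ xs → sumBy g xs ℕ.≤ sumBy h xs
sumBy-mono g≤h []       = z≤n
sumBy-mono g≤h (x ∷ xs) = ℕ.+-mono-≤ (g≤h x) (sumBy-mono g≤h xs)

sumBy-concatMap : ∀ (g : B → ℕ) (f : A → List B) xs →
                  sumBy g (concatMap f xs) ≡ sumBy (sumBy g ∘ f) xs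
sumBy-concatMap g f []       = refl
sumBy-concatMap g f (x ∷ xs) =
  trans (sumBy-++ g (f x) (concatMap f xs)) (cong (sumBy g (f x) ℕ.+_) (sumBy-concatMap g f xs))

module FinSum = CommutativeMonoidSum ℕ.+-0-commutativeMonoid

sumBy-tabulate : ∀ {n} (g : A → ℕ) (f : Fin n → A) → sumBy g (tabulate f) ≡ FinSum.sum (g ∘ f)
sumBy-tabulate {n = zero}  g f = refl
sumBy-tabulate {n = suc n} g f = cong (g (f Fin.zero) ℕ.+_) (sumBy-tabulate g (f ∘ Fin.suc))

sumBy-allFin-permute : ∀ {n} (π : Permutation′ n) (g : Fin n → ℕ) →
                       sumBy g (allFin n) ≡ sumBy (g ∘ (π ⟨$⟩ʳ_)) (allFin n)
sumBy-allFin-permute π g = begin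
  sumBy g (allFin _)                ≡⟨ sumBy-tabulate g id ⟩
  FinSum.sum g                      ≡⟨ FinSum.sum-permute g π ⟩
  FinSum.sum (g ∘ (π ⟨$⟩ʳ_))        ≡⟨ sumBy-tabulate (g ∘ (π ⟨$⟩ʳ_)) id ⟨
  sumBy (g ∘ (π ⟨$⟩ʳ_)) (allFin _)  ∎
  where open ≡-Reasoning

sumBy-allLists-permute : ∀ {n} (π : Permutation′ n) m (g : List (Fin n) → ℕ) →
  sumBy g (allLists m n) ≡ sumBy (g ∘ map (π ⟨$⟩ʳ_)) (allLists m n)
sumBy-allLists-permute π zero    g = refl
sumBy-allLists-permute {n} π (suc m) g = begin
  sumBy g (concatMap extend (allFin n))
    ≡⟨ sumBy-concatMap g extend (allFin n) ⟩
  sumBy (λ c → sumBy g (extend c)) (allFin n)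
    ≡⟨ sumBy-cong (λ c → sumBy-map g (c ∷_) tails) (allFin n) ⟩
  sumBy (λ c → sumBy (λ τ → g (c ∷ τ)) tails) (allFin n)
    ≡⟨ sumBy-allFin-permute π _ ⟩
  sumBy (λ c → sumBy (λ τ → g (f c ∷ τ)) tails) (allFin n)
    ≡⟨ sumBy-cong (λ c → sumBy-allLists-permute π m (λ τ → g (f c ∷ τ))) (allFin n) ⟩
  sumBy (λ c → sumBy (λ τ → g (map f (c ∷ τ))) tails) (allFin n)
    ≡⟨ sumBy-cong (λ c → sumBy-map (g ∘ map f) (c ∷_) tails) (allFin n) ⟨
  sumBy (λ c → sumBy (g ∘ map f) (extend c)) (allFin n)
    ≡⟨ sumBy-concatMap (g ∘ map f) extend (allFin n) ⟨
  sumBy (g ∘ map f) (concatMap extend (allFin n))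
    ∎
  where
  open ≡-Reasoning
  f = π ⟨$⟩ʳ_
  tails = allLists m n
  extend : Fin n → List (List (Fin n))
  extend c = map (c ∷_) tails

indicator : {P : Pred A ℓ} → Decidable P → A → ℕ
indicator P? x = if does (P? x) then 1 else 0

indicator-mono : ∀ {P Q : Pred A ℓ} (P? : Decidable P) (Q? : Decidable Q) {x y} →
                 (P x → Q y) → indicator P? x ℕ.≤ indicator Q? y
indicator-mono P? Q? {x} {y} Px⇒Qy with P? x | Q? y
... | no _   | _      = z≤n
... | yes _  | yes _  = ℕ.≤-refl
... | yes Px | no ¬Qy = contradiction (Px⇒Qy Px) ¬Qy

length-filter-filter : ∀ {P Q : Pred A ℓ} (P? : Decidable P) (Q? : Decidable Q) xs →
  length (filter P? (filter Q? xs)) ≡ sumBy (indicator (Q? ∩? P?)) xs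
length-filter-filter P? Q? []       = refl
length-filter-filter P? Q? (x ∷ xs) with does (Q? x)
... | false = length-filter-filter P? Q? xs
... | true with does (P? x)
...   | false = length-filter-filter P? Q? xs
...   | true  = cong suc (length-filter-filter P? Q? xs)

module _ {n} {f : Fin n → Fin n} (f-injective : Injective _≡_ _≡_ f) where

  ⌊≟⌋-map : ∀ a z → ⌊ f a Fin.≟ f z ⌋ ≡ ⌊ a Fin.≟ z ⌋
  ⌊≟⌋-map a z = trans (isYes≗does (f a Fin.≟ f z))
    (trans (does-⇔ (mk⇔ (f-injective {a} {z}) (cong f)) (f a Fin.≟ f z) (a Fin.≟ z))
           (sym (isYes≗does (a Fin.≟ z))))

  any-≟-map : ∀ a xs →
              any (λ z → ⌊ f a Fin.≟ z ⌋) (map f xs) ≡ any (λ z → ⌊ a Fin.≟ z ⌋) xs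
  any-≟-map a xs = trans (cong or (sym (map-∘ xs))) (cong or (map-cong (⌊≟⌋-map a) xs))

  distinct-map : ∀ xs → distinct (map f xs) ≡ distinct xs
  distinct-map []       = refl
  distinct-map (a ∷ xs) = cong₂ (λ u v → not u ∧ v) (any-≟-map a xs) (distinct-map xs)

∈⇒any-≟ : ∀ {n} {z : Fin n} {zs} → z ∈ zs → any (λ v → ⌊ z Fin.≟ v ⌋) zs ≡ true
∈⇒any-≟ {z = z} (here {xs = zs} refl) =
  cong (_∨ any (λ v → ⌊ z Fin.≟ v ⌋) zs)
       (trans (isYes≗does (z Fin.≟ z)) (dec-true (z Fin.≟ z) refl))
∈⇒any-≟ {z = z} (there {x = w} z∈zs)  =
  trans (cong (⌊ z Fin.≟ w ⌋ ∨_) (∈⇒any-≟ z∈zs)) (∨-zeroʳ _)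

distinct⇒head∉tail : ∀ {n} {z : Fin n} {zs} → distinct (z ∷ zs) ≡ true → z ∉ zs
distinct⇒head∉tail {zs = zs} d z∈zs =
  contradiction (subst (λ b → not b ∧ distinct zs ≡ true) (∈⇒any-≟ z∈zs) d) λ ()

distinct-tail : ∀ {n} {z : Fin n} {zs} → distinct (z ∷ zs) ≡ true → distinct zs ≡ true
distinct-tail {z = z} {zs} d with not (any (λ v → ⌊ z Fin.≟ v ⌋) zs)
... | true = d

countSel-mono : ∀ {n} (alg : Permutation′ n → List (Fin n) → Maybe (Fin n)) (σ π : Permutation′ n)
  {x y : Fin n} →
  (∀ τ → distinct τ ≡ true → alg σ τ ≡ just y → alg σ (map (π ⟨$⟩ʳ_) τ) ≡ just x) →
  countSel alg σ y ℕ.≤ countSel alg σ x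
countSel-mono {n} alg σ π {x} {y} simulate = begin
  countSel alg σ y                ≡⟨ length-filter-filter (selects y) isDistinct τs ⟩
  sumBy (indicator (valid y)) τs  ≤⟨ sumBy-mono transport τs ⟩
  sumBy (indicator (valid x) ∘ map f) τs
                                  ≡⟨ sumBy-allLists-permute π n _ ⟨
  sumBy (indicator (valid x)) τs  ≡⟨ length-filter-filter (selects x) isDistinct τs ⟨
  countSel alg σ x                ∎
  where
  open ℕ.≤-Reasoning
  f = π ⟨$⟩ʳ_
  τs = allLists n n
  isDistinct = λ (τ : List (Fin n)) → Data.Bool._≟_ (distinct τ) true
  selects = λ c τ → Maybe.≡-dec Fin._≟_ (alg σ τ) (just c)
  valid = λ c → isDistinct ∩? selects c

  f-injective : Injective _≡_ _≡_ f
  f-injective fu≡fv = trans (sym (inverseˡ π)) (trans (cong (π ⟨$⟩ˡ_) fu≡fv) (inverseˡ π))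

  transport : ∀ τ → indicator (valid y) τ ℕ.≤ indicator (valid x) (map f τ)
  transport τ = indicator-mono (valid y) (valid x) λ (d , sel) →
    trans (distinct-map f-injective τ) d , simulate τ d sel

-- Literally the test in secGo, so that 'with stops …' abstracts it in unfolded secGo goals.
stops : ∀ {n} → ℕ → Permutation′ n → ℕ → List (Fin n) → Fin n → Bool
stops t σ k pre x = ⌊ t ℕ.≤? k ⌋ ∧ all (better σ x) pre

secGo-∈ : ∀ {n} t (σ : Permutation′ n) k pre rest {r} → secGo t σ k pre rest ≡ just r → r ∈ rest
secGo-∈ t σ k pre (x ∷ [])           refl = here refl
secGo-∈ t σ k pre (x ∷ rest@(_ ∷ _)) h
  with ih ← secGo-∈ t σ (suc k) (pre ++ List.[ x ]) rest | stops t σ k pre x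
... | true  = here (just-injective (sym h))
... | false = there (ih h)

all-map : ∀ (p : B → Bool) (f : A → B) xs → all p (map f xs) ≡ all (p ∘ f) xs
all-map p f xs = cong and (sym (map-∘ xs))

∧-all-mono : ∀ {p q : A → Bool} c → (∀ w → p w ≡ true → q w ≡ true) →
             ∀ xs → c ∧ all p xs ≡ true → c ∧ all q xs ≡ true
∧-all-mono          true p⇒q []       h = refl
∧-all-mono {p = p}  true p⇒q (x ∷ xs) h with p x in px
... | true = cong₂ _∧_ (p⇒q x px) (∧-all-mono true p⇒q xs h)

better⇒< : ∀ {n} (σ : Permutation′ n) {z w} → better σ z w ≡ true → rank σ z ℕ.< rank σ w
better⇒< σ {z} {w} h with rank σ z ℕ.<? rank σ w
... | yes z<w = z<w

<⇒better : ∀ {n} (σ : Permutation′ n) {z w} → rank σ z ℕ.< rank σ w → better σ z w ≡ true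
<⇒better σ {z} {w} z<w = trans (isYes≗does _) (dec-true (rank σ z ℕ.<? rank σ w) z<w)

module SecretarySwap {n} (σ : Permutation′ n) (f : Fin n → Fin n) (f-involutive : ∀ z → f (f z) ≡ z)
  {x y : Fin n} (x≢y : x ≢ y) (fy≡x : f y ≡ x)
  (rank-preserved : ∀ {z w} → z ≢ x → rank σ z ℕ.< rank σ w → rank σ (f z) ℕ.< rank σ (f w))
  where

  f-injective : ∀ {u v} → f u ≡ f v → u ≡ v
  f-injective {u} {v} fu≡fv = trans (sym (f-involutive u)) (trans (cong f fu≡fv) (f-involutive v))

  better-preserved : ∀ {z w} → z ≢ x → better σ z w ≡ true → better σ (f z) (f w) ≡ true
  better-preserved z≢x = <⇒better σ ∘ rank-preserved z≢x ∘ better⇒< σ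

  better-y⇒better-x : ∀ w → better σ y w ≡ true → better σ x (f w) ≡ true
  better-y⇒better-x w = subst (λ u → better σ u (f w) ≡ true) fy≡x ∘ better-preserved (x≢y ∘ sym)

  better-reflected : ∀ {z} → z ≢ y → ∀ w → better σ (f z) (f w) ≡ true → better σ z w ≡ true
  better-reflected {z} z≢y w =
    subst₂ (λ u v → better σ u v ≡ true) (f-involutive z) (f-involutive w) ∘
    better-preserved (λ fz≡x → z≢y (f-injective (trans fz≡x (sym fy≡x))))

  stops-swap : ∀ t k pre → stops t σ k pre y ≡ true → stops t σ k (map f pre) x ≡ true
  stops-swap t k pre h =
    trans (cong (⌊ t ℕ.≤? k ⌋ ∧_) (all-map (better σ x) f pre))
          (∧-all-mono _ better-y⇒better-x pre h)

  stops-reflected : ∀ t k pre {z} → z ≢ y →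
                    stops t σ k (map f pre) (f z) ≡ true → stops t σ k pre z ≡ true
  stops-reflected t k pre z≢y h =
    ∧-all-mono _ (better-reflected z≢y) pre (trans (sym (cong (⌊ t ℕ.≤? k ⌋ ∧_) (all-map _ f pre))) h)

  secGo-swap : ∀ t k pre rest → distinct rest ≡ true →
               secGo t σ k pre rest ≡ just y → secGo t σ k (map f pre) (map f rest) ≡ just x
  secGo-swap t k pre (z ∷ [])           _ refl = cong just fy≡x
  secGo-swap t k pre (z ∷ rest@(_ ∷ _)) d h
    with ih ← secGo-swap t (suc k) (pre ++ List.[ z ]) rest (distinct-tail {z = z} {rest} d) | z Fin.≟ y
  ... | yes refl with stops t σ k pre y in stop
  ...   | true  rewrite fy≡x | stops-swap t k pre stop = refl
  ...   | false = contradiction (secGo-∈ t σ (suc k) _ rest h) (distinct⇒head∉tail d)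
  secGo-swap t k pre (z ∷ rest@(_ ∷ _)) d h
      | no z≢y with stops t σ k pre z in stop | stops t σ k (map f pre) (f z) in stop′
  ...   | true  | _     = contradiction (just-injective h) z≢y
  ...   | false | true  = contradiction (trans (sym (stops-reflected t k pre z≢y stop′)) stop) λ ()
  ...   | false | false =
    subst (λ pre′ → secGo t σ (suc k) pre′ (map f rest) ≡ just x) (map-++ f pre List.[ z ]) (ih h)

  blind-swap : ∀ τ → blind σ τ ≡ just y → blind σ (map f τ) ≡ just x
  blind-swap (z ∷ τ) refl = cong just fy≡x

transpose-matchˡ : ∀ {n} (i j : Fin n) → PC.transpose i j i ≡ j
transpose-matchˡ i j rewrite dec-true (i Fin.≟ i) refl = refl

transpose-matchʳ : ∀ {n} (i j : Fin n) → PC.transpose i j j ≡ i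
transpose-matchʳ i j with j Fin.≟ i
... | yes refl = refl
... | no  _    rewrite dec-true (j Fin.≟ j) refl = refl

transpose-mismatch : ∀ {n} {i j k : Fin n} → k ≢ i → k ≢ j → PC.transpose i j k ≡ k
transpose-mismatch {i = i} {j} {k} k≢i k≢j
  rewrite dec-false (k Fin.≟ i) k≢i | dec-false (k Fin.≟ j) k≢j = refl

module AdjacentTransposition {n} (σ : Permutation′ n) {a b : Fin n} (b≡1+a : toℕ b ≡ suc (toℕ a)) where

  x y : Fin n
  x = σ ⟨$⟩ʳ a
  y = σ ⟨$⟩ʳ b

  f : Fin n → Fin n
  f = Perm.transpose x y ⟨$⟩ʳ_

  rank-x : rank σ x ≡ toℕ a
  rank-x = cong toℕ (inverseˡ σ)

  rank-y : rank σ y ≡ suc (toℕ a)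
  rank-y = trans (cong toℕ (inverseˡ σ)) b≡1+a

  x-before-y : rank σ x ℕ.< rank σ y
  x-before-y = subst₂ ℕ._<_ (sym rank-x) (sym rank-y) ℕ.≤-refl

  x≢y : x ≢ y
  x≢y x≡y = ℕ.<-irrefl (cong (rank σ) x≡y) x-before-y

  rank-x-unique : ∀ {z} → rank σ z ≡ rank σ x → z ≡ x
  rank-x-unique eq = trans (sym (inverseʳ σ)) (cong (σ ⟨$⟩ʳ_) (Fin.toℕ-injective (trans eq rank-x)))

  below-y⇒below-x : ∀ {z} → z ≢ x → rank σ z ℕ.< rank σ y → rank σ z ℕ.< rank σ x
  below-y⇒below-x z≢x z<y =
    ℕ.≤∧≢⇒< (subst (_ ℕ.≤_) (sym rank-x) (ℕ.s≤s⁻¹ (subst (_ ℕ.<_) rank-y z<y)))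
            (z≢x ∘ rank-x-unique)

  data Position (z : Fin n) : Set where
    at-x      : z ≡ x → Position z
    at-y      : z ≡ y → Position z
    elsewhere : z ≢ x → z ≢ y → Position z

  position : ∀ z → Position z
  position z with z Fin.≟ x | z Fin.≟ y
  ... | yes z≡x | _       = at-x z≡x
  ... | no  _   | yes z≡y = at-y z≡y
  ... | no z≢x  | no z≢y  = elsewhere z≢x z≢y

  f-involutive : ∀ z → f (f z) ≡ z
  f-involutive z with position z
  ... | at-x refl = trans (cong f (transpose-matchˡ x y)) (transpose-matchʳ x y)
  ... | at-y refl = trans (cong f (transpose-matchʳ x y)) (transpose-matchˡ x y)
  ... | elsewhere z≢x z≢y = trans (cong f (transpose-mismatch z≢x z≢y)) (transpose-mismatch z≢x z≢y)

  rank-preserved : ∀ {z w} → z ≢ x → rank σ z ℕ.< rank σ w → rank σ (f z) ℕ.< rank σ (f w)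
  rank-preserved {z} {w} z≢x z<w with position z | position w
  ... | at-x z≡x        | _         = contradiction z≡x z≢x
  ... | at-y refl       | at-x refl = contradiction z<w (ℕ.<-asym x-before-y)
  ... | at-y refl       | at-y refl = contradiction z<w (ℕ.<-irrefl refl)
  ... | at-y refl       | elsewhere w≢x w≢y
    rewrite transpose-matchʳ x y | transpose-mismatch w≢x w≢y = ℕ.<-trans x-before-y z<w
  ... | elsewhere _ z≢y | at-x refl
    rewrite transpose-mismatch z≢x z≢y | transpose-matchˡ x y = ℕ.<-trans z<w x-before-y
  ... | elsewhere _ z≢y | at-y refl
    rewrite transpose-mismatch z≢x z≢y | transpose-matchʳ x y = below-y⇒below-x z≢x z<w
  ... | elsewhere _ z≢y | elsewhere w≢x w≢y
    rewrite transpose-mismatch z≢x z≢y | transpose-mismatch w≢x w≢y = z<w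

  open SecretarySwap σ f f-involutive x≢y (transpose-matchʳ x y) rank-preserved

  countSel-secretary-y≤x : countSel secretary σ y ℕ.≤ countSel secretary σ x
  countSel-secretary-y≤x = countSel-mono secretary σ (Perm.transpose x y) (λ τ d → secGo-swap _ 1 [] τ d)

  countSel-blind-y≤x : countSel blind σ y ℕ.≤ countSel blind σ x
  countSel-blind-y≤x = countSel-mono blind σ (Perm.transpose x y) (λ τ _ → blind-swap τ)

-- (+ i) / suc d is by definition fromℚᵘ (mkℚᵘ (+ i) d), so compare unnormalised fractions.
/-monoˡ-≤ : ∀ d .{{_ : ℕ.NonZero d}} {i j} → i ℕ.≤ j → (+ i) ℚ./ d ≤ (+ j) ℚ./ d
/-monoˡ-≤ (suc d) {i} {j} i≤j = ℚ.toℚᵘ-cancel-≤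
  (ℚᵘ.≤-respʳ-≃ (ℚᵘ.≃-sym (ℚ.toℚᵘ-fromℚᵘ (ℚᵘ.mkℚᵘ (+ j) d)))
    (ℚᵘ.≤-respˡ-≃ (ℚᵘ.≃-sym (ℚ.toℚᵘ-fromℚᵘ (ℚᵘ.mkℚᵘ (+ i) d)))
      (ℚᵘ.*≤* (ℤ.*-monoʳ-≤-nonNeg (+ suc d) (+≤+ i≤j)))))

probSel-mono : ∀ {n} (alg : Permutation′ n → List (Fin n) → Maybe (Fin n)) σ {c d} →
               countSel alg σ c ℕ.≤ countSel alg σ d → probSel alg σ c ≤ probSel alg σ d
probSel-mono {n} alg σ = /-monoˡ-≤ (n ℕ.!) {{n ℕ.!≢0}}

convex-combination-mono : ∀ {p u u′ v v′} → 0ℚ ≤ p → p ≤ 1ℚ → u ≤ u′ → v ≤ v′ →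
  p ℚ.* u ℚ.+ (1ℚ ℚ.- p) ℚ.* v ≤ p ℚ.* u′ ℚ.+ (1ℚ ℚ.- p) ℚ.* v′
convex-combination-mono {p} 0≤p p≤1 u≤u′ v≤v′ = ℚ.+-mono-≤
  (ℚ.*-monoˡ-≤-nonNeg p {{ℚ.nonNegative 0≤p}} u≤u′)
  (ℚ.*-monoˡ-≤-nonNeg (1ℚ ℚ.- p) {{ℚ.nonNegative 0≤1-p}} v≤v′)
  where
  0≤1-p : 0ℚ ≤ 1ℚ ℚ.- p
  0≤1-p = subst (_≤ 1ℚ ℚ.- p) (ℚ.+-inverseʳ p) (ℚ.+-monoˡ-≤ (ℚ.- p) p≤1)

antitone-from-adjacent : ∀ {n} (q : Fin n → ℚ) →
  (∀ {a b} → toℕ b ≡ suc (toℕ a) → q b ≤ q a) → ∀ {i j} → i Fin.≤ j → q j ≤ q i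
antitone-from-adjacent {suc n} q step {i} =
  <-weakInduction-startingFrom (λ j → q j ≤ q i) ℚ.≤-refl
    (λ j qj≤qi → ℚ.≤-trans (step (cong suc (sym (Fin.toℕ-inject₁ j)))) qj≤qi)

lemma1 : (n : ℕ) (σ : Permutation′ n) (p : ℚ) → 0ℚ ≤ p → p ≤ 1ℚ →
    (i j : Fin n) → i Data.Fin.≤ j → qMix p σ j ≤ qMix p σ i
lemma1 n σ p 0≤p p≤1 i j = antitone-from-adjacent (qMix p σ) adjacent
  where
  adjacent : ∀ {a b} → toℕ b ≡ suc (toℕ a) → qMix p σ b ≤ qMix p σ a
  adjacent b≡1+a = convex-combination-mono 0≤p p≤1
    (probSel-mono secretary σ countSel-secretary-y≤x) (probSel-mono blind σ countSel-blind-y≤x)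
    where open AdjacentTransposition σ b≡1+a
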